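{- Let $M\in\mathbb N^{[\infty]}$ and let $k>2$ be an integer. Then $M^{[k]}$, as a subspace of $\mathbb N^{[k]}$, has Cantor–Bendixson index $k$ if and only if there exist $p\in\mathbb N$ and $N\in\mathbb N^{[\infty]}$ such that $\{p-1,p,p+1,\dots,p+k-1\}\subseteq M$ and $\{i,i+1,\dots,i+k-1\}\subseteq M$ for all $i\in N$.
   Context: $A^{[k]}$ denotes the set of $k$-element subsets of $A$, and $\mathbb N^{[\infty]}$ the set of infinite subsets of $\mathbb N$. $\mathbb N^{[k]}$ is given the order topology of the lexicographic order ($s<_{lex}t$ iff $\min(s\triangle t)\in s$), which well-orders it; $M^{[k]}$ gets the subspace topology. Cantor–Bendixson derivative: for a subset $A$, $A'$ is the set of points of $A$ that are limit points of $A$; $A^{(0)}=A$, $A^{(\gamma+1)}=(A^{(\gamma)})'$, intersections at limit stages; the CB index is the least $\gamma$ with $A^{(\gamma)}=A^{(\gamma+1)}$. -}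

module Defs where

open import Level using (0ℓ)
open import Data.Nat using (ℕ; _≤_; _<_)
open import Data.Fin as Fin using (Fin)
open import Data.Vec using (Vec; lookup)
open import Data.Vec.Membership.Propositional using (_∈_)
open import Data.Maybe using (Maybe; nothing; just)
open import Data.Product using (Σ; ∃; _×_)
open import Data.Unit using (⊤)
open import Relation.Nullary using (¬_)
open import Relation.Unary using (Pred; _≐_)
open import Relation.Binary.PropositionalEquality using (_≢_)

-- An infinite subset of ℕ (element of ℕ^[∞]) : unbounded predicate.
Infinite : Pred ℕ 0ℓ → Set
Infinite N = ∀ n → ∃ λ m → n ≤ m × N m

-- A k-element subset of ℕ is represented by its increasing enumeration.
Increasing : ∀ {k} → Vec ℕ k → Set
Increasing {k} v = ∀ (i j : Fin k) → i Fin.< j → lookup v i < lookup v j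

_<lex_ : ∀ {k} → Vec ℕ k → Vec ℕ k → Set
s <lex t = ∃ λ m → m ∈ s × ¬ (m ∈ t)
                 × (∀ n → n < m → (n ∈ s → n ∈ t) × (n ∈ t → n ∈ s))

-- Basic open sets of the order topology on ℕ^[k]: intervals (a,b),
-- rays (a,→), (←,b), and the whole space (nothing = no endpoint).
-- Endpoints are points of ℕ^[k].
LowerOK : ∀ {k} → Maybe (Vec ℕ k) → Vec ℕ k → Set
LowerOK nothing  x = ⊤
LowerOK (just a) x = Increasing a × a <lex x

UpperOK : ∀ {k} → Maybe (Vec ℕ k) → Vec ℕ k → Set
UpperOK nothing  x = ⊤
UpperOK (just b) x = Increasing b × x <lex b

InBasic : ∀ {k} → Maybe (Vec ℕ k) → Maybe (Vec ℕ k) → Vec ℕ k → Set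
InBasic lo hi x = LowerOK lo x × UpperOK hi x

LimitPoint : ∀ {k} → Pred (Vec ℕ k) 0ℓ → Vec ℕ k → Set
LimitPoint A x = ∀ lo hi → InBasic lo hi x →
  ∃ λ y → A y × y ≢ x × InBasic lo hi y

derive : ∀ {k} → Pred (Vec ℕ k) 0ℓ → Pred (Vec ℕ k) 0ℓ
derive A x = A x × LimitPoint A x

deriv^ : ∀ {k} → ℕ → Pred (Vec ℕ k) 0ℓ → Pred (Vec ℕ k) 0ℓ
deriv^ ℕ.zero    A = A
deriv^ (ℕ.suc n) A = derive (deriv^ n A)

-- CB index equals the finite number n: A^(n) = A^(n+1), and for every j < n
-- A^(j) ≠ A^(j+1) (since A^(j+1) ⊆ A^(j), witnessed by a point of the difference).
CBIndexIs : ∀ {k} → Pred (Vec ℕ k) 0ℓ → ℕ → Set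
CBIndexIs A n = (deriv^ n A ≐ deriv^ (ℕ.suc n) A)
  × (∀ j → j < n → ∃ λ x → deriv^ j A x × ¬ deriv^ (ℕ.suc j) A x)

_^[_] : Pred ℕ 0ℓ → (k : ℕ) → Pred (Vec ℕ k) 0ℓ
(M ^[ k ]) v = Increasing v × (∀ i → M (lookup v i))

module Submission where

-- Every point has an
-- immediate successor, so limit points are exactly the points approximated
-- from below (limit⇒approachable, approachable⇒limit). A vector consecutive
-- from position i (x_i, x_i + 1, …) is least among ascending vectors with its
-- first i+1 entries, so approximating it from below forces entry i down by one
-- (lowered-approximant). For the derived sets D j of M^[k] this gives, by
-- mutual induction on j, that points of D j end in a consecutive run of length
-- j+1 whose first entry cannot be lowered (derived-consecutive,
-- derived-no-room); in particular D k is empty. Conversely, if M has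
-- arbitrarily late runs of length k, a point ending in such a run whose first
-- entry can be lowered inside M lies in D j: it is the limit of the vectors
-- that lower this entry and then jump to a run (Backward). The forward
-- direction reads the runs off a point of D (k-1) and its approximants in
-- D (k-2); this is where k ≥ 3 is needed.

open import Defs
open import Level using (0ℓ)
open import Data.Nat using (ℕ; zero; suc; _+_; _∸_; _≤_; _<_; z≤n; s≤s; _<?_)
open import Data.Nat.Properties
open import Data.Fin as Fin using (Fin; toℕ; fromℕ<)
import Data.Fin.Properties as FinP
open import Data.Vec using (Vec; []; _∷_; lookup)
open import Data.Vec.Relation.Unary.Any using (here; there)
open import Data.Vec.Membership.Propositional using (_∈_)
open import Data.Maybe using (nothing; just)
open import Data.Product using (Σ; ∃; _×_; _,_; proj₁; proj₂)
open import Data.Sum using (_⊎_; inj₁; inj₂)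
open import Data.Unit using (tt)
open import Data.Empty using (⊥-elim)
open import Relation.Nullary using (¬_; yes; no)
open import Relation.Unary using (Pred)
open import Relation.Binary using (tri<; tri≈; tri>)
open import Relation.Binary.PropositionalEquality
open import Function.Bundles using (_⇔_; mk⇔)
open import Function.Base using (case_of_)

-- A vector read as a sequence indexed by ℕ (entries past the end read as 0).
_!_ : ∀ {k} → Vec ℕ k → ℕ → ℕ
[] ! n = 0
(x ∷ v) ! zero = x
(x ∷ v) ! suc n = v ! n

lookup≡! : ∀ {k} (v : Vec ℕ k) (i : Fin k) → lookup v i ≡ v ! toℕ i
lookup≡! (x ∷ v) Fin.zero = refl
lookup≡! (x ∷ v) (Fin.suc i) = lookup≡! v i

!≡lookup : ∀ {k} (v : Vec ℕ k) {a} (a<k : a < k) → v ! a ≡ lookup v (fromℕ< a<k)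
!≡lookup v a<k = trans (cong (v !_) (sym (FinP.toℕ-fromℕ< a<k))) (sym (lookup≡! v _))

fromSeq : ∀ {k} → (ℕ → ℕ) → Vec ℕ k
fromSeq {zero} f = []
fromSeq {suc k} f = f 0 ∷ fromSeq (λ n → f (suc n))

fromSeq-! : ∀ {k} (f : ℕ → ℕ) {n} → n < k → fromSeq {k} f ! n ≡ f n
fromSeq-! {suc k} f {zero} _ = refl
fromSeq-! {suc k} f {suc n} n<k = fromSeq-! {k} (λ m → f (suc m)) (≤-pred n<k)

!-ext : ∀ {k} (u v : Vec ℕ k) → (∀ n → n < k → u ! n ≡ v ! n) → u ≡ v
!-ext [] [] _ = refl
!-ext (x ∷ u) (y ∷ v) h = cong₂ _∷_ (h 0 (s≤s z≤n)) (!-ext u v λ n n<k → h (suc n) (s≤s n<k))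

∈⇒! : ∀ {k m} (v : Vec ℕ k) → m ∈ v → ∃ λ a → a < k × v ! a ≡ m
∈⇒! (x ∷ v) (here m≡x) = 0 , s≤s z≤n , sym m≡x
∈⇒! (x ∷ v) (there m∈v) with ∈⇒! v m∈v
... | a , a<k , va≡m = suc a , s≤s a<k , va≡m

!∈ : ∀ {k} (v : Vec ℕ k) {a} → a < k → v ! a ∈ v
!∈ (x ∷ v) {zero} _ = here refl
!∈ (x ∷ v) {suc a} a<k = there (!∈ v (≤-pred a<k))

Agree : ∀ {k} → ℕ → Vec ℕ k → Vec ℕ k → Set
Agree i u v = ∀ j → j < i → u ! j ≡ v ! j

Ascending : ∀ {k} → Vec ℕ k → Set
Ascending {k} v = ∀ a b → a < b → b < k → v ! a < v ! b

Increasing⇒Ascending : ∀ {k} (v : Vec ℕ k) → Increasing v → Ascending v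
Increasing⇒Ascending v inc a b a<b b<k =
  subst₂ _<_ (sym (!≡lookup v a<k)) (sym (!≡lookup v b<k))
    (inc (fromℕ< a<k) (fromℕ< b<k)
      (subst₂ _<_ (sym (FinP.toℕ-fromℕ< a<k)) (sym (FinP.toℕ-fromℕ< b<k)) a<b))
  where a<k = <-trans a<b b<k

Ascending⇒Increasing : ∀ {k} (v : Vec ℕ k) → Ascending v → Increasing v
Ascending⇒Increasing v asc i j i<j =
  subst₂ _<_ (sym (lookup≡! v i)) (sym (lookup≡! v j)) (asc (toℕ i) (toℕ j) i<j (FinP.toℕ<n j))

ascending-by-steps : ∀ {k} (v : Vec ℕ k) → (∀ a → suc a < k → v ! a < v ! suc a) → Ascending v
ascending-by-steps v step a (suc b) a<1+b 1+b<k with m<1+n⇒m<n∨m≡n a<1+b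
... | inj₁ a<b = <-trans (ascending-by-steps v step a b a<b (<-trans (n<1+n b) 1+b<k)) (step b 1+b<k)
... | inj₂ refl = step a 1+b<k

ascending-≤ : ∀ {k} (v : Vec ℕ k) → Ascending v → ∀ {a b} → a ≤ b → b < k → v ! a ≤ v ! b
ascending-≤ v asc a≤b b<k with m≤n⇒m<n∨m≡n a≤b
... | inj₁ a<b = <⇒≤ (asc _ _ a<b b<k)
... | inj₂ refl = ≤-refl

ascending-grows : ∀ {k} (v : Vec ℕ k) → Ascending v → ∀ i d → i + d < k → v ! i + d ≤ v ! (i + d)
ascending-grows v asc i zero _ rewrite +-identityʳ i | +-identityʳ (v ! i) = ≤-refl
ascending-grows v asc i (suc d) i+1+d<k rewrite +-suc i d | +-suc (v ! i) d =
  <-≤-trans (s≤s (ascending-grows v asc i d (<-trans (n<1+n _) i+1+d<k)))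
            (asc (i + d) (suc (i + d)) (n<1+n _) i+1+d<k)

index-below : ∀ {k n} (u : Vec ℕ k) → Ascending u → ∀ {i} → n ∈ u → n < u ! i →
  ∃ λ c → c < i × u ! c ≡ n
index-below u asc {i} n∈u n<ui with ∈⇒! u n∈u
... | c , c<k , uc≡n with c <? i
...   | yes c<i = c , c<i , uc≡n
...   | no c≮i = ⊥-elim (<⇒≱ n<ui (subst (u ! i ≤_) uc≡n (ascending-≤ u asc (≮⇒≥ c≮i) c<k)))

record _≺_ {k} (x y : Vec ℕ k) : Set where
  constructor lex
  field
    at       : ℕ
    at<k     : at < k
    prefix   : Agree at x y
    increase : x ! at < y ! at

≺⇒≢ : ∀ {k} {x y : Vec ℕ k} → x ≺ y → x ≢ y
≺⇒≢ (lex _ _ _ lt) refl = n≮n _ lt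

≺-trans : ∀ {k} {x y z : Vec ℕ k} → x ≺ y → y ≺ z → x ≺ z
≺-trans {x = x} {y} {z} (lex i i<k xy lt) (lex j j<k yz lt′) with <-cmp i j
... | tri< i<j _ _ = lex i i<k (λ n n<i → trans (xy n n<i) (yz n (<-trans n<i i<j))) (subst (x ! i <_) (yz i i<j) lt)
... | tri≈ _ refl _ = lex i i<k (λ n n<i → trans (xy n n<i) (yz n n<i)) (<-trans lt lt′)
... | tri> _ _ j<i = lex j j<k (λ n n<j → trans (xy n (<-trans n<j j<i)) (yz n n<j))
                           (subst (_< z ! j) (sym (xy j j<i)) lt′)

≺-cons : ∀ {k} (a : ℕ) {u v : Vec ℕ k} → u ≺ v → (a ∷ u) ≺ (a ∷ v)
≺-cons a (lex i i<k ag lt) = lex (suc i) (s≤s i<k) (λ { zero _ → refl ; (suc j) j<i → ag j (≤-pred j<i) }) lt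

≺-trichotomy : ∀ {k} (u v : Vec ℕ k) → u ≺ v ⊎ u ≡ v ⊎ v ≺ u
≺-trichotomy [] [] = inj₂ (inj₁ refl)
≺-trichotomy (a ∷ u) (b ∷ v) with <-cmp a b
... | tri< a<b _ _ = inj₁ (lex 0 (s≤s z≤n) (λ _ ()) a<b)
... | tri> _ _ b<a = inj₂ (inj₂ (lex 0 (s≤s z≤n) (λ _ ()) b<a))
... | tri≈ _ refl _ with ≺-trichotomy u v
...   | inj₁ u≺v = inj₁ (≺-cons a u≺v)
...   | inj₂ (inj₁ refl) = inj₂ (inj₁ refl)
...   | inj₂ (inj₂ v≺u) = inj₂ (inj₂ (≺-cons a v≺u))

≺-agree⇒≤ : ∀ {k} {x y : Vec ℕ k} → x ≺ y → ∀ {i} → Agree i x y → x ! i ≤ y ! i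
≺-agree⇒≤ (lex p _ agp lt) {i} ag with <-cmp i p
... | tri< i<p _ _ = ≤-reflexive (agp i i<p)
... | tri≈ _ refl _ = <⇒≤ lt
... | tri> _ _ p<i = ⊥-elim (<-irrefl (ag p p<i) lt)

agree-suc : ∀ {k i} {u v : Vec ℕ k} → Agree i u v → u ! i ≡ v ! i → Agree (suc i) u v
agree-suc ag eq j j<1+i with m<1+n⇒m<n∨m≡n j<1+i
... | inj₁ j<i = ag j j<i
... | inj₂ refl = eq

≺-squeeze : ∀ {k} {s y z : Vec ℕ k} → s ≺ y → y ≺ z → ∀ i → Agree i s z → Agree i y z
≺-squeeze s≺y y≺z zero _ j ()
≺-squeeze {s = s} {y} {z} s≺y y≺z (suc i) sz =
  agree-suc {u = y} {z} yz (≤-antisym (≺-agree⇒≤ y≺z yz) si≤yi)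
  where
  yz : Agree i y z
  yz = ≺-squeeze s≺y y≺z i (λ n n<i → sz n (<-trans n<i (n<1+n i)))
  si≤yi : z ! i ≤ y ! i
  si≤yi = subst (_≤ y ! i) (sz i (n<1+n i))
            (≺-agree⇒≤ s≺y (λ n n<i → trans (sz n (<-trans n<i (n<1+n i))) (sym (yz n n<i))))

first-difference-∉ : ∀ {k} (s t : Vec ℕ k) → Ascending s → Ascending t →
  ∀ {i} → i < k → Agree i s t → s ! i < t ! i → ¬ (s ! i ∈ t)
first-difference-∉ s t ascs asct {i} i<k ag lt si∈t with index-below t asct si∈t lt
... | c , c<i , tc≡si = n≮n _ (subst (_< s ! i) (trans (ag c c<i) tc≡si) (ascs c i c<i i<k))

≺⇒<lex : ∀ {k} (s t : Vec ℕ k) → Ascending s → Ascending t → s ≺ t → s <lex t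
≺⇒<lex {k} s t ascs asct (lex i i<k ag lt) =
  s ! i , !∈ s i<k , first-difference-∉ s t ascs asct i<k ag lt , λ n n<si → s⇒t n<si , t⇒s n<si
  where
  s⇒t : ∀ {n} → n < s ! i → n ∈ s → n ∈ t
  s⇒t n<si n∈s with index-below s ascs n∈s n<si
  ... | c , c<i , sc≡n = subst (_∈ t) (trans (sym (ag c c<i)) sc≡n) (!∈ t (<-trans c<i i<k))
  t⇒s : ∀ {n} → n < s ! i → n ∈ t → n ∈ s
  t⇒s n<si n∈t with index-below t asct n∈t (<-trans n<si lt)
  ... | c , c<i , tc≡n = subst (_∈ s) (trans (ag c c<i) tc≡n) (!∈ s (<-trans c<i i<k))

<lex⇒≺ : ∀ {k} (s t : Vec ℕ k) → Ascending s → Ascending t → s <lex t → s ≺ t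
<lex⇒≺ s t ascs asct (m , m∈s , m∉t , agr) with ≺-trichotomy s t
... | inj₁ s≺t = s≺t
... | inj₂ (inj₁ refl) = ⊥-elim (m∉t m∈s)
... | inj₂ (inj₂ (lex i i<k ag lt)) with t ! i <? m
...   | yes ti<m = ⊥-elim (first-difference-∉ t s asct ascs i<k ag lt (proj₂ (agr (t ! i) ti<m) (!∈ t i<k)))
...   | no ti≮m with index-below s ascs m∈s (≤-<-trans (≮⇒≥ ti≮m) lt)
...     | c , c<i , sc≡m = ⊥-elim (m∉t (subst (_∈ t) (trans (ag c c<i) sc≡m) (!∈ t (<-trans c<i i<k))))

-- The lexicographic successor of x in ℕ^[k]: the last entry increased by one.
bump : ∀ {n} → Vec ℕ (suc n) → Vec ℕ (suc n)
bump {zero} (a ∷ []) = suc a ∷ []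
bump {suc n} (a ∷ v) = a ∷ bump v

bump-init : ∀ {n} (x : Vec ℕ (suc n)) {j} → j < n → bump x ! j ≡ x ! j
bump-init {suc n} (a ∷ v) {zero} _ = refl
bump-init {suc n} (a ∷ v) {suc j} j<n = bump-init v (≤-pred j<n)

bump-last : ∀ {n} (x : Vec ℕ (suc n)) → bump x ! n ≡ suc (x ! n)
bump-last {zero} (a ∷ []) = refl
bump-last {suc n} (a ∷ v) = bump-last v

≺-bump : ∀ {n} (x : Vec ℕ (suc n)) → x ≺ bump x
≺-bump {n} x = lex n (n<1+n n) (λ j j<n → sym (bump-init x j<n)) (subst (x ! n <_) (sym (bump-last x)) (n<1+n _))

bump-ascending : ∀ {n} (x : Vec ℕ (suc n)) → Ascending x → Ascending (bump x)
bump-ascending {n} x asc = ascending-by-steps (bump x) step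
  where
  x≤bump : ∀ {j} → j ≤ n → x ! j ≤ bump x ! j
  x≤bump j≤n with m≤n⇒m<n∨m≡n j≤n
  ... | inj₁ j<n = ≤-reflexive (sym (bump-init x j<n))
  ... | inj₂ refl = subst (x ! n ≤_) (sym (bump-last x)) (n≤1+n _)
  step : ∀ a → suc a < suc n → bump x ! a < bump x ! suc a
  step a (s≤s a+1≤n) = subst (_< bump x ! suc a) (sym (bump-init x a+1≤n))
                         (<-≤-trans (asc a (suc a) (n<1+n a) (s≤s a+1≤n)) (x≤bump a+1≤n))

≺-bump⇒≼ : ∀ {n} (x y : Vec ℕ (suc n)) → y ≺ bump x → y ≺ x ⊎ y ≡ x
≺-bump⇒≼ {n} x y (lex i i<1+n ag lt) with m<1+n⇒m<n∨m≡n i<1+n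
... | inj₁ i<n = inj₁ (lex i i<1+n (λ j j<i → trans (ag j j<i) (bump-init x (<-trans j<i i<n)))
                         (subst (y ! i <_) (bump-init x i<n) lt))
... | inj₂ refl = last-entry (m<1+n⇒m<n∨m≡n (subst (y ! n <_) (bump-last x) lt))
  where
  prefix : Agree n y x
  prefix j j<n = trans (ag j j<n) (bump-init x j<n)
  last-entry : y ! n < x ! n ⊎ y ! n ≡ x ! n → y ≺ x ⊎ y ≡ x
  last-entry (inj₁ yn<xn) = inj₁ (lex n i<1+n prefix yn<xn)
  last-entry (inj₂ yn≡xn) = inj₂ (!-ext y x (agree-suc {u = y} {x} prefix yn≡xn))

-- Limit points in ℕ^[k] are exactly the points approximated from below:
-- x has a lexicographic successor, so every neighbourhood of x contains an
-- interval (s, x], and conversely.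
ApproachableFromBelow : ∀ {n} → Pred (Vec ℕ (suc n)) 0ℓ → Vec ℕ (suc n) → Set
ApproachableFromBelow B x =
  (∃ λ y → B y × y ≺ x) × (∀ s → Ascending s → s ≺ x → ∃ λ y → B y × s ≺ y × y ≺ x)

module _ {n} {B : Pred (Vec ℕ (suc n)) 0ℓ} (B-asc : ∀ y → B y → Ascending y)
         {x : Vec ℕ (suc n)} (x-asc : Ascending x) where

  limit⇒approachable : LimitPoint B x → ApproachableFromBelow B x
  limit⇒approachable L = below-everything , below-lower-bound
    where
    bump-above : UpperOK (just (bump x)) x
    bump-above = Ascending⇒Increasing (bump x) (bump-ascending x x-asc) ,
                 ≺⇒<lex x (bump x) x-asc (bump-ascending x x-asc) (≺-bump x)
    near-below : ∀ lo → LowerOK lo x → ∃ λ y → B y × LowerOK lo y × y ≺ x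
    near-below lo lo-x with L lo (just (bump x)) (lo-x , bump-above)
    ... | y , By , y≢x , lo-y , (_ , y<bump)
          with ≺-bump⇒≼ x y (<lex⇒≺ y (bump x) (B-asc y By) (bump-ascending x x-asc) y<bump)
    ...   | inj₁ y≺x = y , By , lo-y , y≺x
    ...   | inj₂ y≡x = ⊥-elim (y≢x y≡x)
    below-everything : ∃ λ y → B y × y ≺ x
    below-everything with near-below nothing tt
    ... | y , By , _ , y≺x = y , By , y≺x
    below-lower-bound : ∀ s → Ascending s → s ≺ x → ∃ λ y → B y × s ≺ y × y ≺ x
    below-lower-bound s s-asc s≺x
      with near-below (just s) (Ascending⇒Increasing s s-asc , ≺⇒<lex s x s-asc x-asc s≺x)
    ... | y , By , (_ , s<y) , y≺x = y , By , <lex⇒≺ s y s-asc (B-asc y By) s<y , y≺x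

  approachable⇒limit : ApproachableFromBelow B x → LimitPoint B x
  approachable⇒limit (below-everything , below-lower-bound) lo hi (lo-x , hi-x) = witness (near-below lo lo-x)
    where
    near-below : ∀ lo → LowerOK lo x → ∃ λ y → B y × LowerOK lo y × y ≺ x
    near-below nothing _ = let y , By , y≺x = below-everything in y , By , tt , y≺x
    near-below (just a) (a-inc , a<x) =
      let a-asc = Increasing⇒Ascending a a-inc
          y , By , a≺y , y≺x = below-lower-bound a a-asc (<lex⇒≺ a x a-asc x-asc a<x)
      in y , By , (a-inc , ≺⇒<lex a y a-asc (B-asc y By) a≺y) , y≺x
    stays-below : ∀ {y} → Ascending y → y ≺ x → ∀ hi → UpperOK hi x → UpperOK hi y
    stays-below y-asc y≺x nothing _ = tt
    stays-below {y} y-asc y≺x (just b) (b-inc , x<b) =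
      let b-asc = Increasing⇒Ascending b b-inc
      in b-inc , ≺⇒<lex y b y-asc b-asc (≺-trans y≺x (<lex⇒≺ x b x-asc b-asc x<b))
    witness : (∃ λ y → B y × LowerOK lo y × y ≺ x) → ∃ λ y → B y × y ≢ x × InBasic lo hi y
    witness (y , By , lo-y , y≺x) = y , By , ≺⇒≢ y≺x , lo-y , stays-below (B-asc y By) y≺x hi hi-x

∸1< : ∀ {a} → 1 ≤ a → a ∸ 1 < a
∸1< {suc a} _ = n<1+n a

<⇒≤∸1 : ∀ {a b} → a < b → a ≤ b ∸ 1
<⇒≤∸1 {b = suc b} (s≤s a≤b) = a≤b

∸1+suc : ∀ {a} → 1 ≤ a → ∀ d → (a ∸ 1) + suc d ≡ a + d
∸1+suc {suc a} _ d = +-suc a d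

ConsecutiveFrom : ∀ {k} → ℕ → Vec ℕ k → Set
ConsecutiveFrom {k} i v = ∀ d → i + d < k → v ! (i + d) ≡ v ! i + d

consecutive-at-last : ∀ {k} {v : Vec ℕ k} {i} → i + 1 ≡ k → ConsecutiveFrom i v
consecutive-at-last {v = v} {i} _ zero _ rewrite +-identityʳ i | +-identityʳ (v ! i) = refl
consecutive-at-last {i = i} refl (suc d) i+1+d<i+1 with +-cancelˡ-< i (suc d) 1 i+1+d<i+1
... | s≤s ()

consecutive-extend : ∀ {k} {v : Vec ℕ k} {i} → ConsecutiveFrom (suc i) v → v ! suc i ≡ suc (v ! i) →
  ConsecutiveFrom i v
consecutive-extend {v = v} {i} _ _ zero _ rewrite +-identityʳ i | +-identityʳ (v ! i) = refl
consecutive-extend {v = v} {i} cons next (suc d) i+1+d<k rewrite +-suc i d | +-suc (v ! i) d =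
  trans (cons d i+1+d<k) (cong (_+ d) next)

consecutive-minimal : ∀ {k} {v y : Vec ℕ k} {i} → ConsecutiveFrom i v → Ascending y →
  Agree i y v → v ! i ≤ y ! i → ¬ y ≺ v
consecutive-minimal {v = v} {y} {i} cons asc ag vi≤yi (lex q q<k _ lt) with q <? i
... | yes q<i = <-irrefl (ag q q<i) lt
... | no q≮i with m≤n⇒∃[o]m+o≡n (≮⇒≥ q≮i)
...   | d , refl = <⇒≱ lt (begin
          v ! (i + d) ≡⟨ cons d q<k ⟩
          v ! i + d   ≤⟨ +-monoˡ-≤ d vi≤yi ⟩
          y ! i + d   ≤⟨ ascending-grows y asc i d q<k ⟩
          y ! (i + d) ∎)
  where open ≤-Reasoning

RoomBelow : ∀ {k} → ℕ → Vec ℕ k → Set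
RoomBelow i x = 1 ≤ x ! i × (∀ j → suc j ≡ i → suc (x ! j) < x ! i)

StepsUp : ℕ → (ℕ → ℕ) → Set
StepsUp n f = ∀ a → suc a < n → f a < f (suc a)

ascending⇒steps-up : ∀ {k} (x : Vec ℕ k) → Ascending x → StepsUp k (x !_)
ascending⇒steps-up x asc a a+1<k = asc a (suc a) (n<1+n a) a+1<k

steps-up⇒ascending : ∀ {k} (f : ℕ → ℕ) → StepsUp k f → Ascending (fromSeq {k} f)
steps-up⇒ascending {k} f st = ascending-by-steps (fromSeq f) λ a a+1<k →
  subst₂ _<_ (sym (fromSeq-! f (<-trans (n<1+n a) a+1<k))) (sym (fromSeq-! f a+1<k)) (st a a+1<k)

lowerSeq : (ℕ → ℕ) → ℕ → ℕ → ℕ → ℕ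
lowerSeq f zero w zero = f 0 ∸ 1
lowerSeq f zero w (suc d) = suc (w + d)
lowerSeq f (suc i) w zero = f 0
lowerSeq f (suc i) w (suc q) = lowerSeq (λ n → f (suc n)) i w q

lowerSeq-before : ∀ f i w {q} → q < i → lowerSeq f i w q ≡ f q
lowerSeq-before f (suc i) w {zero} _ = refl
lowerSeq-before f (suc i) w {suc q} q<i = lowerSeq-before (λ n → f (suc n)) i w (≤-pred q<i)

lowerSeq-at : ∀ f i w → lowerSeq f i w i ≡ f i ∸ 1
lowerSeq-at f zero w = refl
lowerSeq-at f (suc i) w = lowerSeq-at (λ n → f (suc n)) i w

lowerSeq-after : ∀ f i w d → lowerSeq f i w (suc (i + d)) ≡ suc (w + d)
lowerSeq-after f zero w d = refl
lowerSeq-after f (suc i) w d = lowerSeq-after (λ n → f (suc n)) i w d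

lowerSeq-steps-up : ∀ n f i w → StepsUp n f → (∀ j → suc j ≡ i → suc (f j) < f i) → f i ∸ 1 ≤ w →
  StepsUp n (lowerSeq f i w)
lowerSeq-steps-up n f zero w _ _ fi≤w zero _ = s≤s (≤-trans fi≤w (m≤m+n w 0))
lowerSeq-steps-up n f zero w _ _ _ (suc d) _ = s≤s (+-monoʳ-< w (n<1+n d))
lowerSeq-steps-up n f (suc zero) w _ room _ zero _ = <⇒≤∸1 (room 0 refl)
lowerSeq-steps-up n f (suc (suc i)) w st _ _ zero 1<n = st 0 1<n
lowerSeq-steps-up (suc n) f (suc i) w st room fi≤w (suc a) (s≤s a+1<n) =
  lowerSeq-steps-up n (λ m → f (suc m)) i w (λ b b+1<n → st (suc b) (s≤s b+1<n))
    (λ j j+1≡i → room (suc j) (cong suc j+1≡i)) fi≤w a a+1<n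

lower : ∀ {k} → Vec ℕ k → ℕ → ℕ → Vec ℕ k
lower x i w = fromSeq (lowerSeq (x !_) i w)

module _ {k} (x : Vec ℕ k) {i : ℕ} (w : ℕ) where

  lower-agree : i < k → Agree i (lower x i w) x
  lower-agree i<k q q<i = trans (fromSeq-! (lowerSeq (x !_) i w) (<-trans q<i i<k)) (lowerSeq-before (x !_) i w q<i)

  lower-at : i < k → lower x i w ! i ≡ x ! i ∸ 1
  lower-at i<k = trans (fromSeq-! (lowerSeq (x !_) i w) i<k) (lowerSeq-at (x !_) i w)

  lower-after : ∀ d → suc (i + d) < k → lower x i w ! suc (i + d) ≡ suc (w + d)
  lower-after d lt = trans (fromSeq-! (lowerSeq (x !_) i w) lt) (lowerSeq-after (x !_) i w d)

  lower-next : suc i < k → lower x i w ! suc i ≡ suc w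
  lower-next i+1<k = trans (cong (lower x i w !_) (cong suc (sym (+-identityʳ i))))
    (trans (lower-after 0 (subst (λ m → suc m < k) (sym (+-identityʳ i)) i+1<k)) (cong suc (+-identityʳ w)))

  lower-ascending : Ascending x → RoomBelow i x → x ! i ∸ 1 ≤ w → Ascending (lower x i w)
  lower-ascending asc (_ , room) xi≤w =
    steps-up⇒ascending _ (lowerSeq-steps-up k (x !_) i w (ascending⇒steps-up x asc) room xi≤w)

  lower-≺ : i < k → 1 ≤ x ! i → lower x i w ≺ x
  lower-≺ i<k xi≥1 = lex i i<k (lower-agree i<k) (subst (_< x ! i) (sym (lower-at i<k)) (∸1< xi≥1))

  lower-consecutive : suc i < k → ConsecutiveFrom (suc i) (lower x i w)
  lower-consecutive i+1<k d lt = trans (lower-after d lt) (cong (_+ d) (sym (lower-next i+1<k)))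

  lower-room : suc i < k → 1 ≤ x ! i → x ! i ≤ w → RoomBelow (suc i) (lower x i w)
  lower-room i+1<k xi≥1 xi≤w = subst (1 ≤_) (sym (lower-next i+1<k)) (s≤s z≤n) , λ { j refl →
    subst₂ (λ a b → suc a < b) (sym (lower-at (<-trans (n<1+n i) i+1<k))) (sym (lower-next i+1<k))
      (s≤s (<-≤-trans (∸1< xi≥1) xi≤w)) }

  ≺-lower : ConsecutiveFrom i x → ∀ {s} → Ascending s → s ≺ x → suc i < k → s ! suc i ≤ w →
    s ≺ lower x i w
  ≺-lower cons {s} s-asc s≺x@(lex p p<k agp lt) i+1<k si+1≤w with <-cmp p i
  ... | tri> _ _ i<p = ⊥-elim (consecutive-minimal cons s-asc (λ j j<i → agp j (<-trans j<i i<p))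
                                 (≤-reflexive (sym (agp i i<p))) s≺x)
  ... | tri< p<i _ _ = lex p p<k (λ j j<p → trans (agp j j<p) (sym (lower-agree i<k j (<-trans j<p p<i))))
                         (subst (s ! p <_) (sym (lower-agree i<k p p<i)) lt)
    where i<k = <-trans (n<1+n i) i+1<k
  ... | tri≈ _ refl _ = at-start (m≤n⇒m<n∨m≡n (subst (s ! i ≤_) (sym (lower-at p<k)) (<⇒≤∸1 lt)))
    where
    prefix : Agree i s (lower x i w)
    prefix j j<i = trans (agp j j<i) (sym (lower-agree p<k j j<i))
    at-start : s ! i < lower x i w ! i ⊎ s ! i ≡ lower x i w ! i → s ≺ lower x i w
    at-start (inj₁ si<) = lex i p<k prefix si<
    at-start (inj₂ si≡) = lex (suc i) i+1<k (agree-suc {u = s} {lower x i w} prefix si≡)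
                            (subst (s ! suc i <_) (sym (lower-next i+1<k)) (s≤s si+1≤w))

skipSeq : (ℕ → ℕ) → ℕ → ℕ → ℕ
skipSeq f zero q = f (suc q)
skipSeq f (suc i) zero = f 0
skipSeq f (suc i) (suc q) = skipSeq (λ n → f (suc n)) i q

skipSeq-before : ∀ f i {q} → q < i → skipSeq f i q ≡ f q
skipSeq-before f (suc i) {zero} _ = refl
skipSeq-before f (suc i) {suc q} q<i = skipSeq-before (λ n → f (suc n)) i (≤-pred q<i)

skipSeq-from : ∀ f i {q} → i ≤ q → skipSeq f i q ≡ f (suc q)
skipSeq-from f zero _ = refl
skipSeq-from f (suc i) {suc q} i≤q = skipSeq-from (λ n → f (suc n)) i (≤-pred i≤q)

skipSeq-increasing : ∀ f → (∀ a → f a < f (suc a)) → ∀ i a → skipSeq f i a < skipSeq f i (suc a)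
skipSeq-increasing f inc zero a = inc (suc a)
skipSeq-increasing f inc (suc zero) zero = <-trans (inc 0) (inc 1)
skipSeq-increasing f inc (suc (suc i)) zero = inc 0
skipSeq-increasing f inc (suc i) (suc a) = skipSeq-increasing (λ n → f (suc n)) (λ b → inc (suc b)) i a

^-member : ∀ {k} (M : Pred ℕ 0ℓ) (y : Vec ℕ k) → (M ^[ k ]) y → ∀ {j} → j < k → M (y ! j)
^-member M y (_ , y∈M) j<k = subst M (sym (!≡lookup y j<k)) (y∈M (fromℕ< j<k))

^-intro : ∀ {k} (M : Pred ℕ 0ℓ) (y : Vec ℕ k) → Ascending y → (∀ j → j < k → M (y ! j)) → (M ^[ k ]) y
^-intro M y asc y∈M =
  Ascending⇒Increasing y asc , λ f → subst M (sym (lookup≡! y f)) (y∈M (toℕ f) (FinP.toℕ<n f))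

module _ {n} {B : Pred (Vec ℕ (suc n)) 0ℓ} (B-asc : ∀ y → B y → Ascending y)
         {x : Vec ℕ (suc n)} (x-asc : Ascending x) (L : LimitPoint B x) where

  -- (0, 1, …, n) is the least point of ℕ^[n+1], so it is no limit point.
  limit-consecutive-positive : ConsecutiveFrom 0 x → 1 ≤ x ! 0
  limit-consecutive-positive cons with proj₁ (limit⇒approachable B-asc x-asc L)
  ... | y , By , y≺x = n≢0⇒n>0 λ x0≡0 →
    consecutive-minimal cons (B-asc y By) (λ _ ()) (subst (_≤ y ! 0) (sym x0≡0) z≤n) y≺x

  lowered-approximant : ∀ {i} w → i < suc n → ConsecutiveFrom i x → RoomBelow i x → x ! i ∸ 1 ≤ w →
    ∃ λ y → B y × Agree i y x × y ! i ≡ x ! i ∸ 1 × lower x i w ≺ y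
  lowered-approximant {i} w i<k cons room xi≤w =
    squeeze (proj₂ (limit⇒approachable B-asc x-asc L) (lower x i w)
              (lower-ascending x w x-asc room xi≤w) (lower-≺ x w i<k (proj₁ room)))
    where
    squeeze : (∃ λ y → B y × lower x i w ≺ y × y ≺ x) →
      ∃ λ y → B y × Agree i y x × y ! i ≡ x ! i ∸ 1 × lower x i w ≺ y
    squeeze (y , By , s≺y , y≺x) = y , By , prefix , ≤-antisym (<⇒≤∸1 yi<xi) xi∸1≤yi , s≺y
      where
      prefix : Agree i y x
      prefix = ≺-squeeze s≺y y≺x i (lower-agree x w i<k)
      yi<xi : y ! i < x ! i
      yi<xi = ≤∧≢⇒< (≺-agree⇒≤ y≺x prefix) λ yi≡xi →
        consecutive-minimal cons (B-asc y By) prefix (≤-reflexive (sym yi≡xi)) y≺x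
      xi∸1≤yi : x ! i ∸ 1 ≤ y ! i
      xi∸1≤yi = subst (_≤ y ! i) (lower-at x w i<k)
        (≺-agree⇒≤ s≺y λ j j<i → trans (lower-agree x w i<k j j<i) (sym (prefix j j<i)))

  -- So x is not a limit of points consecutive from i: the approximant would
  -- lie above lower x i (x_i - 1), which is itself consecutive from i.
  no-room-at-limit-of-consecutive : ∀ {i} → i < suc n → (∀ y → B y → ConsecutiveFrom i y) →
    ConsecutiveFrom i x → ¬ RoomBelow i x
  no-room-at-limit-of-consecutive {i} i<k B-cons cons room =
    case lowered-approximant (x ! i ∸ 1) i<k cons room ≤-refl of λ { (y , By , prefix , yi≡ , s≺y) →
      consecutive-minimal (B-cons y By) (lower-ascending x (x ! i ∸ 1) x-asc room ≤-refl)
        (λ j j<i → trans (lower-agree x _ i<k j j<i) (sym (prefix j j<i)))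
        (≤-reflexive (trans yi≡ (sym (lower-at x _ i<k)))) s≺y }

  lowered-entry-∈ : ∀ (M : Pred ℕ 0ℓ) {i} → (∀ y → B y → (M ^[ suc n ]) y) → i < suc n →
    ConsecutiveFrom i x → RoomBelow i x → M (x ! i ∸ 1)
  lowered-entry-∈ M {i} B⊆M i<k cons room =
    case lowered-approximant (x ! i ∸ 1) i<k cons room ≤-refl of λ { (y , By , _ , yi≡ , _) →
      subst M yi≡ (^-member M y (B⊆M y By) i<k) }

start<length : ∀ {i j k} → i + suc j ≡ k → i < k
start<length {i} refl = m<m+n i (s≤s z≤n)

module DerivedSets (M : Pred ℕ 0ℓ) (n : ℕ) where

  k : ℕ
  k = suc n

  D : ℕ → Pred (Vec ℕ k) 0ℓ
  D j = deriv^ j (M ^[ k ])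

  D⊆M^k : ∀ j y → D j y → (M ^[ k ]) y
  D⊆M^k zero y My = My
  D⊆M^k (suc j) y (Dy , _) = D⊆M^k j y Dy

  D-ascending : ∀ j y → D j y → Ascending y
  D-ascending j y Dy = Increasing⇒Ascending y (proj₁ (D⊆M^k j y Dy))

  derived-consecutive : ∀ j i → i + suc j ≡ k → ∀ x → D j x → ConsecutiveFrom i x
  derived-no-room : ∀ j i → i + suc j ≡ k → ∀ x → D (suc j) x → ConsecutiveFrom i x → ¬ RoomBelow i x

  derived-consecutive zero i i+1≡k x _ = consecutive-at-last {v = x} i+1≡k
  derived-consecutive (suc j) i i+j+2≡k x (Dx , L) = consecutive-extend {v = x} cons next
    where
    i+1+j+1≡k : suc i + suc j ≡ k
    i+1+j+1≡k = trans (sym (+-suc i (suc j))) i+j+2≡k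
    cons : ConsecutiveFrom (suc i) x
    cons = derived-consecutive j (suc i) i+1+j+1≡k x Dx
    next : x ! suc i ≡ suc (x ! i)
    next with suc (x ! i) <? x ! suc i
    ... | yes gap = ⊥-elim (derived-no-room j (suc i) i+1+j+1≡k x (Dx , L) cons
                      (≤-trans (s≤s z≤n) (<⇒≤ gap) , λ { _ refl → gap }))
    ... | no no-gap = ≤-antisym (≮⇒≥ no-gap) (D-ascending j x Dx i (suc i) (n<1+n i) (start<length i+1+j+1≡k))

  derived-no-room j i i+j+1≡k x (Dx , L) =
    no-room-at-limit-of-consecutive (D-ascending j) (D-ascending j x Dx) L (start<length i+j+1≡k)
      (λ y Dy → derived-consecutive j i i+j+1≡k y Dy)

  -- D k is empty: a point of D k is consecutive from 0 and, being a limit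
  -- point, starts above 0; so its first entry could be lowered.
  derived-empty : ∀ x → ¬ D k x
  derived-empty x (Dx , L) = derived-no-room n 0 refl x (Dx , L) cons
      (limit-consecutive-positive (D-ascending n) (D-ascending n x Dx) L cons , λ _ ())
    where
    cons : ConsecutiveFrom 0 x
    cons = derived-consecutive n 0 refl x Dx

  Block : ℕ → Set
  Block w = ∀ j → j < k → M (w + j)

  BlockCondition : Set₁
  BlockCondition = Σ ℕ λ p → 1 ≤ p × (∀ j → j ≤ k → M ((p ∸ 1) + j))
    × Σ (Pred ℕ 0ℓ) λ N → Infinite N × (∀ i → N i → Block i)

  run-from-lowered : ∀ y {i} → (M ^[ k ]) y → ConsecutiveFrom i y → 1 ≤ y ! i → M (y ! i ∸ 1) →
    ∀ j → i + j ≤ k → M ((y ! i ∸ 1) + j)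
  run-from-lowered y {i} _ _ _ low zero _ = subst M (sym (+-identityʳ _)) low
  run-from-lowered y {i} My cons yi≥1 _ (suc j) i+j+1≤k =
    subst M (trans (cons j i+j<k) (sym (∸1+suc yi≥1 j))) (^-member M y My i+j<k)
    where
    i+j<k : i + j < k
    i+j<k = subst (_≤ k) (+-suc i j) i+j+1≤k

  record Lowerable (j : ℕ) (x : Vec ℕ k) : Set where
    constructor lowerable
    field
      start       : ℕ
      start+j<k   : start + j < k
      consecutive : ConsecutiveFrom start x
      room        : RoomBelow start x
      lowered∈M   : M (x ! start ∸ 1)

  lower-∈M^k : ∀ x {i} w → (M ^[ k ]) x → i < k → RoomBelow i x → M (x ! i ∸ 1) →
    x ! i ∸ 1 ≤ w → Block w → (M ^[ k ]) (lower x i w)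
  lower-∈M^k x {i} w Mx i<k room low xi≤w block =
    ^-intro M (lower x i w) (lower-ascending x w (Increasing⇒Ascending x (proj₁ Mx)) room xi≤w) entry
    where
    entry : ∀ q → q < k → M (lower x i w ! q)
    entry q q<k with <-cmp q i
    ... | tri< q<i _ _ = subst M (sym (lower-agree x w i<k q q<i)) (^-member M x Mx q<k)
    ... | tri≈ _ refl _ = subst M (sym (lower-at x w i<k)) low
    ... | tri> _ _ i<q with m≤n⇒∃[o]m+o≡n i<q
    ...   | d , refl = subst M (trans (+-suc w d) (sym (lower-after x w d q<k)))
                         (block (suc d) (≤-<-trans (s≤s (m≤n+m d i)) q<k))

  module Backward (blocks : Infinite Block) where

    -- Induction on j; x is a limit of the points lower x i w, w a block start,
    -- which are lowerable one step further.
    lowerable-derived : ∀ j x → (M ^[ k ]) x → Lowerable j x → D j x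
    lowerable-derived zero x Mx _ = Mx
    lowerable-derived (suc j) x Mx (lowerable i i+j+1<k cons room low) =
      lowerable-derived j x Mx (lowerable i (<-trans (+-monoʳ-< i (n<1+n j)) i+j+1<k) cons room low) ,
      approachable⇒limit (D-ascending j) x-asc (below-everything , below-lower-bound)
      where
      x-asc : Ascending x
      x-asc = Increasing⇒Ascending x (proj₁ Mx)
      i+1<k : suc i < k
      i+1<k = ≤-<-trans (subst (suc i ≤_) (sym (+-suc i j)) (s≤s (m≤m+n i j))) i+j+1<k
      i<k : i < k
      i<k = <-trans (n<1+n i) i+1<k
      lowered : ∀ b → ∃ λ w → b ≤ w × D j (lower x i w) × lower x i w ≺ x
      lowered b with blocks (b + x ! i)
      ... | w , b+xi≤w , block =
        w , ≤-trans (m≤m+n b _) b+xi≤w ,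
        lowerable-derived j (lower x i w) (lower-∈M^k x w Mx i<k room low (≤-trans (m∸n≤m _ 1) xi≤w) block)
          (lowerable (suc i) (subst (_< k) (+-suc i j) i+j+1<k) (lower-consecutive x w i+1<k)
            (lower-room x w i+1<k (proj₁ room) xi≤w)
            (subst M (cong (_∸ 1) (sym (lower-next x w i+1<k))) (subst M (+-identityʳ w) (block 0 (s≤s z≤n))))) ,
        lower-≺ x w i<k (proj₁ room)
        where
        xi≤w : x ! i ≤ w
        xi≤w = ≤-trans (m≤n+m _ b) b+xi≤w
      below-everything : ∃ λ y → D j y × y ≺ x
      below-everything = case lowered 0 of λ { (w , _ , Dy , y≺x) → lower x i w , Dy , y≺x }
      below-lower-bound : ∀ s → Ascending s → s ≺ x → ∃ λ y → D j y × s ≺ y × y ≺ x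
      below-lower-bound s s-asc s≺x =
        case lowered (s ! suc i) of λ { (w , si+1≤w , Dy , y≺x) →
          lower x i w , Dy , ≺-lower x w cons s-asc s≺x i+1<k si+1≤w , y≺x }

    module _ (p′ : ℕ) (first-run : ∀ j → j ≤ k → M (p′ + j)) where

      skip-point : ℕ → Vec ℕ k
      skip-point i = fromSeq (skipSeq (p′ +_) i)

      module _ {i : ℕ} (i<k : i < k) where

        skip-before : ∀ {q} → q < i → skip-point i ! q ≡ p′ + q
        skip-before q<i = trans (fromSeq-! (skipSeq (p′ +_) i) (<-trans q<i i<k)) (skipSeq-before (p′ +_) i q<i)

        skip-from : ∀ {q} → i ≤ q → q < k → skip-point i ! q ≡ p′ + suc q
        skip-from i≤q q<k = trans (fromSeq-! (skipSeq (p′ +_) i) q<k) (skipSeq-from (p′ +_) i i≤q)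

        skip-consecutive : ConsecutiveFrom i (skip-point i)
        skip-consecutive d i+d<k = begin
          skip-point i ! (i + d) ≡⟨ skip-from (m≤m+n i d) i+d<k ⟩
          p′ + suc (i + d)       ≡⟨ sym (+-assoc p′ (suc i) d) ⟩
          p′ + suc i + d         ≡⟨ cong (_+ d) (sym (skip-from ≤-refl i<k)) ⟩
          skip-point i ! i + d   ∎
          where open ≡-Reasoning

        skip-room : RoomBelow i (skip-point i)
        skip-room = subst (1 ≤_) (sym (skip-from ≤-refl i<k)) (≤-trans (s≤s z≤n) (m≤n+m (suc i) p′)) ,
          λ { j refl → subst₂ (λ a b → suc a < b) (sym (skip-before (n<1+n j))) (sym (skip-from ≤-refl i<k))
                         (subst (_< p′ + suc i) (+-suc p′ j) (+-monoʳ-< p′ (n<1+n i))) }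

        skip-∈M^k : (M ^[ k ]) (skip-point i)
        skip-∈M^k = ^-intro M (skip-point i) skip-ascending entry
          where
          skip-ascending : Ascending (skip-point i)
          skip-ascending = steps-up⇒ascending (skipSeq (p′ +_) i) λ a _ →
            skipSeq-increasing (p′ +_) (λ b → +-monoʳ-< p′ (n<1+n b)) i a
          entry : ∀ q → q < k → M (skip-point i ! q)
          entry q q<k with q <? i
          ... | yes q<i = subst M (sym (skip-before q<i)) (first-run q (<⇒≤ q<k))
          ... | no q≮i = subst M (sym (skip-from (≮⇒≥ q≮i) q<k)) (first-run (suc q) q<k)

        skip-lowered∈M : M (skip-point i ! i ∸ 1)
        skip-lowered∈M =
          subst M (cong (_∸ 1) (sym (trans (skip-from ≤-refl i<k) (+-suc p′ i)))) (first-run i (<⇒≤ i<k))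

      skip-point-separates : ∀ j → j < k → ∃ λ x → D j x × ¬ D (suc j) x
      skip-point-separates j j<k =
        skip-point i ,
        lowerable-derived j (skip-point i) (skip-∈M^k i<k)
          (lowerable i (subst (i + j <_) i+j+1≡k (+-monoʳ-< i (n<1+n j)))
            (skip-consecutive i<k) (skip-room i<k) (skip-lowered∈M i<k)) ,
        λ D[j+1] → derived-no-room j i i+j+1≡k (skip-point i) D[j+1] (skip-consecutive i<k) (skip-room i<k)
        where
        i : ℕ
        i = k ∸ suc j
        i+j+1≡k : i + suc j ≡ k
        i+j+1≡k = m∸n+n≡m j<k
        i<k : i < k
        i<k = start<length i+j+1≡k

  block-condition⇒cb-index : BlockCondition → CBIndexIs (M ^[ k ]) k
  block-condition⇒cb-index (zero , () , _)
  block-condition⇒cb-index (suc p′ , _ , first-run , N , N-infinite , N-blocks) =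
    ((λ {x} Dkx → ⊥-elim (derived-empty x Dkx)) , proj₁) , skip-point-separates p′ first-run
    where
    blocks : Infinite Block
    blocks b = let w , b≤w , Nw = N-infinite b in w , b≤w , N-blocks w Nw
    open Backward blocks

module Forward (M : Pred ℕ 0ℓ) (m : ℕ) where
  open DerivedSets M (suc (suc m))

  block-condition-from-point : ∀ x → D (suc (suc m)) x → BlockCondition
  block-condition-from-point x (Dx , L) =
    x ! 0 , x0≥1 , run-from-lowered x (D⊆M^k (suc (suc m)) x (Dx , L)) cons0 x0≥1 x0∸1∈M ,
    Block , blocks-unbounded , λ _ Bw → Bw
    where
    x-asc : Ascending x
    x-asc = D-ascending (suc (suc m)) x (Dx , L)
    cons0 : ConsecutiveFrom 0 x
    cons0 = derived-consecutive (suc (suc m)) 0 refl x (Dx , L)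
    x0≥1 : 1 ≤ x ! 0
    x0≥1 = limit-consecutive-positive (D-ascending (suc m)) x-asc L cons0
    room0 : RoomBelow 0 x
    room0 = x0≥1 , λ _ ()
    x0∸1∈M : M (x ! 0 ∸ 1)
    x0∸1∈M = lowered-entry-∈ (D-ascending (suc m)) x-asc L M (D⊆M^k (suc m)) (s≤s z≤n) cons0 room0
    -- A point y of D (k-2) just below x, lowered at 0 and jumping past b,
    -- is consecutive from 1 with room below; y_1 - 1 ≥ b starts a block.
    block-beyond : ∀ b →
      (∃ λ y → D (suc m) y × Agree 0 y x × y ! 0 ≡ x ! 0 ∸ 1 × lower x 0 (b + x ! 0) ≺ y) →
      ∃ λ w → b ≤ w × Block w
    block-beyond b (y , (Dy , L′) , _ , y0≡ , s≺y) = y ! 1 ∸ 1 , ≤-trans (m≤m+n b _) (<⇒≤∸1 y1>) ,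
      run-from-lowered y (D⊆M^k (suc m) y (Dy , L′)) cons1 (≤-trans (s≤s z≤n) y1>) y1∸1∈M
      where
      y1> : b + x ! 0 < y ! 1
      y1> = subst (_≤ y ! 1) (lower-next x (b + x ! 0) (s≤s (s≤s z≤n)))
              (≺-agree⇒≤ s≺y λ { zero _ → trans (lower-at x (b + x ! 0) (s≤s z≤n)) (sym y0≡)
                                 ; (suc _) (s≤s ()) })
      cons1 : ConsecutiveFrom 1 y
      cons1 = derived-consecutive (suc m) 1 refl y (Dy , L′)
      room1 : RoomBelow 1 y
      room1 = ≤-trans (s≤s z≤n) y1> , λ { zero refl →
        subst (λ a → suc a < y ! 1) (sym y0≡) (≤-<-trans (≤-trans (∸1< x0≥1) (m≤n+m _ b)) y1>) }
      y1∸1∈M : M (y ! 1 ∸ 1)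
      y1∸1∈M = lowered-entry-∈ (D-ascending m) (D-ascending (suc m) y (Dy , L′)) L′ M (D⊆M^k m)
                 (s≤s (s≤s z≤n)) cons1 room1
    blocks-unbounded : Infinite Block
    blocks-unbounded b = block-beyond b
      (lowered-approximant (D-ascending (suc m)) x-asc L (b + x ! 0) (s≤s z≤n) cons0 room0
        (≤-trans (m∸n≤m _ 1) (m≤n+m _ b)))

mainTheorem5 : (M : Pred ℕ 0ℓ) → Infinite M → (k : ℕ) → 2 < k →
    CBIndexIs (M ^[ k ]) k ⇔
      (Σ ℕ λ p → 1 ≤ p × (∀ j → j ≤ k → M ((p ∸ 1) + j))
        × Σ (Pred ℕ 0ℓ) λ N → Infinite N × (∀ i → N i → ∀ j → j < k → M (i + j)))
mainTheorem5 M _ (suc (suc (suc m))) _ = mk⇔ cb-index⇒block-condition block-condition⇒cb-index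
  where
  open DerivedSets M (suc (suc m))
  cb-index⇒block-condition : CBIndexIs (M ^[ suc (suc (suc m)) ]) (suc (suc (suc m))) → BlockCondition
  cb-index⇒block-condition (_ , separated) =
    let x , Dx , _ = separated (suc (suc m)) (n<1+n _) in Forward.block-condition-from-point M m x Dx
mainTheorem5 M _ zero ()
mainTheorem5 M _ (suc zero) (s≤s ())
mainTheorem5 M _ (suc (suc zero)) (s≤s (s≤s ()))
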